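{- Let $R$ be an unramified dyadic local ring and let $L\cong\langle 1,-1\rangle$. Then \[ Q(L) = R^\times \cup 4R, \qquad Q^\ast(L) = \begin{cases} R^\times\cup 4R & \text{if } R\ne\mathbb{Z}_2,\\ R^\times \cup 8R & \text{if } R = \mathbb{Z}_2.\end{cases}\]
   Context: $R$ is the ring of integers of a nonarchimedean local field of characteristic $0$ in which $2$ is a prime element of $R$; $R=\mathbb{Z}_2$ means $R$ is the ring of $2$-adic integers. $\langle 1,-1\rangle$ is the $R$-lattice with Gram matrix $\mathrm{diag}(1,-1)$ and $Q(v)=B(v,v)$. $Q(L)=\{Q(v):v\in L\}$, and $Q^\ast(L)$ is the set of $Q(v)$ with $v$ a primitive vector of $L$ (one spanning a direct summand of $L$). -}

module Defs where

open import Level using (Level; _⊔_) renaming (suc to lsuc)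
open import Algebra.Bundles using (CommutativeRing)
open import Data.Nat using (ℕ; zero; suc)
open import Data.Product using (Σ; _×_; _,_)
open import Data.Sum using (_⊎_)
open import Data.List using (List)
open import Data.List.Relation.Unary.Any using (Any)
open import Relation.Binary.PropositionalEquality using (_≡_)
open import Relation.Nullary using (¬_)
open import Function.Bundles using (_⇔_)

module RingNotions {c ℓ : Level} (R : CommutativeRing c ℓ) where
  open CommutativeRing R

  _∣_ : Carrier → Carrier → Set (c ⊔ ℓ)
  a ∣ b = Σ Carrier λ d → b ≈ a * d

  Unit : Carrier → Set (c ⊔ ℓ)
  Unit x = Σ Carrier λ y → x * y ≈ 1#

  fromℕ : ℕ → Carrier
  fromℕ zero = 0#
  fromℕ (suc n) = 1# + fromℕ n

  two four eight : Carrier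
  two = fromℕ 2
  four = fromℕ 4
  eight = fromℕ 8

  pow : Carrier → ℕ → Carrier
  pow x zero = 1#
  pow x (suc n) = x * pow x n

-- R is the ring of integers of a nonarchimedean local field of characteristic 0
-- in which 2 is a prime element (an "unramified dyadic local ring").
record UnramifiedDyadic (c ℓ : Level) : Set (lsuc (c ⊔ ℓ)) where
  field
    𝓡 : CommutativeRing c ℓ
  open CommutativeRing 𝓡
  open RingNotions 𝓡
  field
    domain        : ∀ x y → x * y ≈ 0# → (x ≈ 0#) ⊎ (y ≈ 0#)
    char-zero     : ∀ n → fromℕ n ≈ 0# → n ≡ 0
    two-nonunit   : ¬ Unit two
    maximal-2R    : ∀ x → ¬ Unit x → two ∣ x
    separated     : ∀ x → (∀ n → pow two n ∣ x) → x ≈ 0#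
    complete      : (a : ℕ → Carrier) → (∀ n → pow two n ∣ (a (suc n) - a n)) →
                    Σ Carrier λ x → ∀ n → pow two n ∣ (x - a n)
    residue-finite : Σ (List Carrier) λ reps → ∀ x → Any (λ r → two ∣ (x - r)) reps

-- The lattice L ≅ ⟨1,-1⟩ realised as R² with B(e1,e1)=1, B(e2,e2)=-1, B(e1,e2)=0.
module Hyperbolic {c ℓ : Level} (D : UnramifiedDyadic c ℓ) where
  open UnramifiedDyadic D public using (𝓡)
  open CommutativeRing 𝓡 public
  open RingNotions 𝓡 public

  -- "R = ℤ₂": the residue field R/2R is 𝔽₂ (residue degree 1 over ℚ₂).
  IsZ₂ : Set (c ⊔ ℓ)
  IsZ₂ = ∀ x → (two ∣ x) ⊎ (two ∣ (x - 1#))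

  L : Set c
  L = Carrier × Carrier

  _≈L_ : L → L → Set ℓ
  (x , y) ≈L (x' , y') = (x ≈ x') × (y ≈ y')

  _+L_ : L → L → L
  (x , y) +L (x' , y') = (x + x') , (y + y')

  _·L_ : Carrier → L → L
  a ·L (x , y) = (a * x) , (a * y)

  0L : L
  0L = 0# , 0#

  Q : L → Carrier
  Q (x , y) = (x * x) - (y * y)

  record Submodule : Set (lsuc (c ⊔ ℓ)) where
    field
      mem      : L → Set (c ⊔ ℓ)
      mem-resp : ∀ {u w} → u ≈L w → mem u → mem w
      mem-0    : mem 0L
      mem-+    : ∀ {u w} → mem u → mem w → mem (u +L w)
      mem-·    : ∀ a {u} → mem u → mem (a ·L u)

  -- v is primitive: Rv is a direct summand of L, i.e. L = Rv ⊕ N for some submodule N.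
  Primitive : L → Set (lsuc (c ⊔ ℓ))
  Primitive v = Σ Submodule λ N →
    (∀ u → Σ Carrier λ a → Σ L λ n → Submodule.mem N n × (u ≈L ((a ·L v) +L n))) ×
    (∀ a b n m → Submodule.mem N n → Submodule.mem N m →
       ((a ·L v) +L n) ≈L ((b ·L v) +L m) → (a ·L v) ≈L (b ·L v))

  InQ : Carrier → Set (c ⊔ ℓ)
  InQ a = Σ L λ v → Q v ≈ a

  InQ* : Carrier → Set (lsuc (c ⊔ ℓ))
  InQ* a = Σ L λ v → Primitive v × (Q v ≈ a)

module Submission where

-- Q(x, y) = (x - y)(x + y) with x + y ≡ x - y (mod 2): if x - y is a unit then so is Q, and otherwise
-- x - y = 2s and Q = 4s(s + y). Conversely a unit a equals Q(u - kw, -kw) where u² = a + 2k and w = u⁻¹,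
-- and 4c = Q(η + cη⁻¹, cη⁻¹ - η) for every unit η; this vector is primitive once η + cη⁻¹ is a unit.
-- η = 1 does it when c is even (in particular for 8R); for odd c one needs η with η and η - 1 units,
-- which exists exactly when R/2R ≠ 𝔽₂. Over ℤ₂ a primitive vector with Q(v) ∉ R^× has both coordinates
-- odd, whence s(s + y) is even and 8 ∣ Q(v).
-- Constructively, "unit or divisible by 2" comes from the Teichmüller representative: the limit ω of
-- x^(2^(kp)) satisfies ω^(2^p) = ω, so ω(ω^(2^p - 1) - 1) = 0 in the domain R, while ω ≡ x (mod 2).

open import Defs
open import Algebra.Bundles using (CommutativeRing)
open import Algebra.Solver.Ring.AlmostCommutativeRing using (fromCommutativeRing; _-Raw-AlmostCommutative⟶_)
open import Data.Empty using (⊥-elim)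
open import Data.Fin using (Fin; toℕ)
open import Data.Fin.Properties using (pigeonhole)
open import Data.Integer as ℤ using (ℤ; +_; -[1+_]; sign; _◃_; _⊖_)
import Data.Integer.Properties as ℤP
open import Data.List using (List; length; lookup)
open import Data.List.Relation.Unary.All using (lookupAny)
open import Data.List.Relation.Unary.All.Properties using (¬Any⇒All¬)
open import Data.List.Relation.Unary.Any as Any using (Any)
open import Data.List.Relation.Unary.Any.Properties using (lookup-index)
open import Data.Maybe using (Maybe; just; nothing)
open import Data.Nat as ℕ using (ℕ; zero; suc)
import Data.Nat.Properties as ℕP
open import Data.Product using (Σ; _×_; _,_; proj₁; proj₂)
open import Data.Sign as Sign using (Sign)
open import Data.Sum as Sum using (_⊎_; inj₁; inj₂; [_,_]; [_,_]′)
open import Function using (_∘_)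
open import Function.Bundles using (_⇔_; mk⇔)
open import Level using (Level; _⊔_)
open import Relation.Binary.PropositionalEquality as P using (_≡_)
open import Relation.Nullary using (¬_; Dec; yes; no; _×-dec_)

module IntegerSolver {c ℓ : Level} (R : CommutativeRing c ℓ) where
  open CommutativeRing R hiding (zero)
  open import Algebra.Properties.Ring ring using (-‿involutive; -0#≈0#; -‿+-comm; -1*x≈-x)
  open import Algebra.Properties.Semiring.Mult semiring using (×-homo-+; ×1-homo-*) renaming (_×_ to _×ₙ_)
  open import Algebra.Properties.CommutativeSemigroup +-commutativeSemigroup using () renaming (interchange to +-interchange)
  open import Algebra.Properties.CommutativeSemigroup *-commutativeSemigroup using () renaming (interchange to *-interchange)
  open import Relation.Binary.Reasoning.Setoid setoid

  private
    -- ι 1 is 1# itself and ι 2, ι 4, ι 8 unfold to two, four, eight, so solver constants match goals verbatim.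
    ι : ℕ → Carrier
    ι zero = 0#
    ι (suc zero) = 1#
    ι (suc n@(suc _)) = 1# + n ×ₙ 1#

    ι≈×1# : ∀ n → ι n ≈ n ×ₙ 1#
    ι≈×1# zero = refl
    ι≈×1# (suc zero) = sym (+-identityʳ 1#)
    ι≈×1# (suc (suc n)) = refl

    ι-suc : ∀ n → ι (suc n) ≈ 1# + ι n
    ι-suc n = trans (ι≈×1# (suc n)) (+-congˡ (sym (ι≈×1# n)))

    ι-homo-+ : ∀ m n → ι (m ℕ.+ n) ≈ ι m + ι n
    ι-homo-+ m n = trans (ι≈×1# (m ℕ.+ n)) (trans (×-homo-+ 1# m n) (sym (+-cong (ι≈×1# m) (ι≈×1# n))))

    ι-homo-* : ∀ m n → ι (m ℕ.* n) ≈ ι m * ι n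
    ι-homo-* m n = trans (ι≈×1# (m ℕ.* n)) (trans (×1-homo-* m n) (sym (*-cong (ι≈×1# m) (ι≈×1# n))))

    ⟦_⟧ : ℤ → Carrier
    ⟦ + n ⟧ = ι n
    ⟦ -[1+ n ] ⟧ = - ι (suc n)

    ⟦_⟧ₛ : Sign → Carrier
    ⟦ Sign.+ ⟧ₛ = 1#
    ⟦ Sign.- ⟧ₛ = - 1#

    ⟦◃⟧ : ∀ s n → ⟦ s ◃ n ⟧ ≈ ⟦ s ⟧ₛ * ι n
    ⟦◃⟧ s zero = sym (zeroʳ _)
    ⟦◃⟧ Sign.+ (suc n) = sym (*-identityˡ _)
    ⟦◃⟧ Sign.- (suc n) = sym (-1*x≈-x _)

    ⟦⟧≈sign*abs : ∀ i → ⟦ i ⟧ ≈ ⟦ sign i ⟧ₛ * ι ℤ.∣ i ∣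
    ⟦⟧≈sign*abs i = trans (reflexive (P.cong ⟦_⟧ (P.sym (ℤP.◃-inverse i)))) (⟦◃⟧ (sign i) ℤ.∣ i ∣)

    ⟦⟧ₛ-homo-* : ∀ s t → ⟦ s Sign.* t ⟧ₛ ≈ ⟦ s ⟧ₛ * ⟦ t ⟧ₛ
    ⟦⟧ₛ-homo-* Sign.+ t = sym (*-identityˡ _)
    ⟦⟧ₛ-homo-* Sign.- Sign.+ = sym (*-identityʳ _)
    ⟦⟧ₛ-homo-* Sign.- Sign.- = sym (trans (-1*x≈-x _) (-‿involutive _))

    ⟦⟧-homo-* : ∀ i j → ⟦ i ℤ.* j ⟧ ≈ ⟦ i ⟧ * ⟦ j ⟧
    ⟦⟧-homo-* i j = begin
      ⟦ i ℤ.* j ⟧                                              ≈⟨ ⟦◃⟧ (sign i Sign.* sign j) (ℤ.∣ i ∣ ℕ.* ℤ.∣ j ∣) ⟩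
      ⟦ sign i Sign.* sign j ⟧ₛ * ι (ℤ.∣ i ∣ ℕ.* ℤ.∣ j ∣)       ≈⟨ *-cong (⟦⟧ₛ-homo-* (sign i) (sign j)) (ι-homo-* ℤ.∣ i ∣ ℤ.∣ j ∣) ⟩
      (⟦ sign i ⟧ₛ * ⟦ sign j ⟧ₛ) * (ι ℤ.∣ i ∣ * ι ℤ.∣ j ∣)    ≈⟨ *-interchange _ _ _ _ ⟩
      (⟦ sign i ⟧ₛ * ι ℤ.∣ i ∣) * (⟦ sign j ⟧ₛ * ι ℤ.∣ j ∣)    ≈⟨ *-cong (⟦⟧≈sign*abs i) (⟦⟧≈sign*abs j) ⟨
      ⟦ i ⟧ * ⟦ j ⟧                                            ∎

    ⟦⟧-homo-neg : ∀ i → ⟦ ℤ.- i ⟧ ≈ - ⟦ i ⟧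
    ⟦⟧-homo-neg (+ zero) = sym -0#≈0#
    ⟦⟧-homo-neg (+ suc n) = refl
    ⟦⟧-homo-neg -[1+ n ] = sym (-‿involutive _)

    ⟦⊖⟧ : ∀ m n → ⟦ m ⊖ n ⟧ ≈ ι m - ι n
    ⟦⊖⟧ zero n = begin
      ⟦ zero ⊖ n ⟧     ≡⟨ P.cong ⟦_⟧ (ℤP.⊖-≤ {0} {n} ℕ.z≤n) ⟩
      ⟦ ℤ.- (+ n) ⟧    ≈⟨ ⟦⟧-homo-neg (+ n) ⟩
      - ι n            ≈⟨ +-identityˡ _ ⟨
      0# - ι n         ∎
    ⟦⊖⟧ (suc m) zero = begin
      ι (suc m)        ≈⟨ +-identityʳ _ ⟨
      ι (suc m) + 0#   ≈⟨ +-congˡ -0#≈0# ⟨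
      ι (suc m) - 0#   ∎
    ⟦⊖⟧ (suc m) (suc n) = begin
      ⟦ suc m ⊖ suc n ⟧             ≡⟨ P.cong ⟦_⟧ (ℤP.[1+m]⊖[1+n]≡m⊖n m n) ⟩
      ⟦ m ⊖ n ⟧                     ≈⟨ ⟦⊖⟧ m n ⟩
      ι m - ι n                     ≈⟨ +-identityˡ _ ⟨
      0# + (ι m - ι n)              ≈⟨ +-congʳ (-‿inverseʳ 1#) ⟨
      (1# - 1#) + (ι m - ι n)       ≈⟨ +-interchange _ _ _ _ ⟩
      (1# + ι m) + (- 1# + - ι n)   ≈⟨ +-congˡ (-‿+-comm 1# (ι n)) ⟩
      (1# + ι m) - (1# + ι n)       ≈⟨ +-cong (ι-suc m) (-‿cong (ι-suc n)) ⟨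
      ι (suc m) - ι (suc n)         ∎

    ⟦⟧-homo-+ : ∀ i j → ⟦ i ℤ.+ j ⟧ ≈ ⟦ i ⟧ + ⟦ j ⟧
    ⟦⟧-homo-+ (+ m) (+ n) = ι-homo-+ m n
    ⟦⟧-homo-+ (+ m) -[1+ n ] = ⟦⊖⟧ m (suc n)
    ⟦⟧-homo-+ -[1+ m ] (+ n) = trans (⟦⊖⟧ n (suc m)) (+-comm _ _)
    ⟦⟧-homo-+ -[1+ m ] -[1+ n ] = begin
      - ι (suc (suc (m ℕ.+ n)))     ≡⟨ P.cong (λ k → - ι (suc k)) (ℕP.+-suc m n) ⟨
      - ι (suc m ℕ.+ suc n)         ≈⟨ -‿cong (ι-homo-+ (suc m) (suc n)) ⟩
      - (ι (suc m) + ι (suc n))     ≈⟨ -‿+-comm _ _ ⟨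
      - ι (suc m) - ι (suc n)       ∎

    ℤ⟶R : ℤ.+-*-rawRing -Raw-AlmostCommutative⟶ fromCommutativeRing R
    ℤ⟶R = record
      { ⟦_⟧ = ⟦_⟧ ; +-homo = ⟦⟧-homo-+ ; *-homo = ⟦⟧-homo-* ; -‿homo = ⟦⟧-homo-neg
      ; 0-homo = refl ; 1-homo = refl }

    ⟦⟧-≟ : ∀ i j → Maybe (⟦ i ⟧ ≈ ⟦ j ⟧)
    ⟦⟧-≟ i j with i ℤ.≟ j
    ... | yes P.refl = just refl
    ... | no _ = nothing

  open import Algebra.Solver.Ring ℤ.+-*-rawRing (fromCommutativeRing R) ℤ⟶R ⟦⟧-≟ public

module Divisibility {c ℓ : Level} (R : CommutativeRing c ℓ) where
  open CommutativeRing R hiding (zero)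
  open RingNotions R
  open IntegerSolver R using (solve; _:=_; _:*_; :-_)
  open import Relation.Binary.Reasoning.Setoid setoid

  ∣-respʳ : ∀ {d x y} → x ≈ y → d ∣ x → d ∣ y
  ∣-respʳ x≈y (e , x≈de) = e , trans (sym x≈y) x≈de

  ≈0⇒∣ : ∀ {d x} → x ≈ 0# → d ∣ x
  ≈0⇒∣ {d} x≈0 = 0# , trans x≈0 (sym (zeroʳ d))

  1∣x : ∀ x → 1# ∣ x
  1∣x x = x , sym (*-identityˡ x)

  x∣x*y : ∀ x y → x ∣ (x * y)
  x∣x*y x y = y , refl

  ∣-trans : ∀ {x y z} → x ∣ y → y ∣ z → x ∣ z
  ∣-trans {x} (d , y≈xd) (e , z≈ye) = d * e , trans z≈ye (trans (*-congʳ y≈xd) (*-assoc x d e))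

  ∣-+ : ∀ {d x y} → d ∣ x → d ∣ y → d ∣ (x + y)
  ∣-+ {d} (e , x≈de) (f , y≈df) = e + f , trans (+-cong x≈de y≈df) (sym (distribˡ d e f))

  ∣-neg : ∀ {d x} → d ∣ x → d ∣ (- x)
  ∣-neg {d} (e , x≈de) = - e , trans (-‿cong x≈de) (solve 2 (λ d e → :- (d :* e) := d :* (:- e)) refl d e)

  ∣-- : ∀ {d x y} → d ∣ x → d ∣ y → d ∣ (x - y)
  ∣-- d∣x d∣y = ∣-+ d∣x (∣-neg d∣y)

  ∣-*ˡ : ∀ {d x} y → d ∣ x → d ∣ (y * x)
  ∣-*ˡ {d} y (e , x≈de) = y * e , trans (*-congˡ x≈de) (solve 3 (λ y d e → y :* (d :* e) := d :* (y :* e)) refl y d e)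

  ∣-*ʳ : ∀ {d x} y → d ∣ x → d ∣ (x * y)
  ∣-*ʳ {d} {x} y d∣x = ∣-respʳ (*-comm y x) (∣-*ˡ y d∣x)

  Unit-resp : ∀ {x y} → x ≈ y → Unit x → Unit y
  Unit-resp x≈y (x⁻¹ , xx⁻¹≈1) = x⁻¹ , trans (*-congʳ (sym x≈y)) xx⁻¹≈1

  Unit-* : ∀ {x y} → Unit x → Unit y → Unit (x * y)
  Unit-* {x} {y} (x⁻¹ , xx⁻¹≈1) (y⁻¹ , yy⁻¹≈1) = x⁻¹ * y⁻¹ ,
    trans (solve 4 (λ x y x' y' → (x :* y) :* (x' :* y') := (x :* x') :* (y :* y')) refl x y x⁻¹ y⁻¹)
          (trans (*-cong xx⁻¹≈1 yy⁻¹≈1) (*-identityˡ 1#))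

  Unit-*⇒Unitˡ : ∀ {x y} → Unit (x * y) → Unit x
  Unit-*⇒Unitˡ {x} {y} (z , xyz≈1) = y * z , trans (sym (*-assoc x y z)) xyz≈1

  Unit-cancelˡ : ∀ {u x} → Unit u → u * x ≈ 0# → x ≈ 0#
  Unit-cancelˡ {u} {x} (u⁻¹ , uu⁻¹≈1) ux≈0 = begin
    x               ≈⟨ *-identityˡ x ⟨
    1# * x          ≈⟨ *-congʳ uu⁻¹≈1 ⟨
    (u * u⁻¹) * x   ≈⟨ solve 3 (λ u u' x → (u :* u') :* x := u' :* (u :* x)) refl u u⁻¹ x ⟩
    u⁻¹ * (u * x)   ≈⟨ *-congˡ ux≈0 ⟩
    u⁻¹ * 0#        ≈⟨ zeroʳ u⁻¹ ⟩
    0#              ∎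

module Congruence {c ℓ : Level} (R : CommutativeRing c ℓ) where
  open CommutativeRing R hiding (zero)
  open RingNotions R
  open IntegerSolver R using (solve; _:=_; _:+_; _:*_; _:-_; :-_; con)
  open Divisibility R

  infix 4 _≡_[mod2^_]
  record _≡_[mod2^_] (x y : Carrier) (n : ℕ) : Set (c ⊔ ℓ) where
    constructor mod2^
    field divides : pow two n ∣ (x - y)
  open _≡_[mod2^_] public

  two∣⇒≡[mod2^1] : ∀ {x y} → two ∣ (x - y) → x ≡ y [mod2^ 1 ]
  two∣⇒≡[mod2^1] (e , d≈2e) = mod2^ (e , trans d≈2e (*-congʳ (sym (*-identityʳ two))))

  ≡[mod2^1]⇒two∣ : ∀ {x y} → x ≡ y [mod2^ 1 ] → two ∣ (x - y)
  ≡[mod2^1]⇒two∣ (mod2^ (e , d≈2e)) = e , trans d≈2e (*-congʳ (*-identityʳ two))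

  ≡-mod-sym : ∀ {n x y} → x ≡ y [mod2^ n ] → y ≡ x [mod2^ n ]
  ≡-mod-sym {x = x} {y} (mod2^ 2ⁿ∣x-y) =
    mod2^ (∣-respʳ (solve 2 (λ x y → :- (x :- y) := y :- x) refl x y) (∣-neg 2ⁿ∣x-y))

  ≡-mod-trans : ∀ {n x y z} → x ≡ y [mod2^ n ] → y ≡ z [mod2^ n ] → x ≡ z [mod2^ n ]
  ≡-mod-trans {x = x} {y} {z} (mod2^ 2ⁿ∣x-y) (mod2^ 2ⁿ∣y-z) =
    mod2^ (∣-respʳ (solve 3 (λ x y z → (x :- y) :+ (y :- z) := x :- z) refl x y z) (∣-+ 2ⁿ∣x-y 2ⁿ∣y-z))

  ≡-mod-pred : ∀ {n x y} → x ≡ y [mod2^ suc n ] → x ≡ y [mod2^ n ]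
  ≡-mod-pred {n} (mod2^ (e , d≈2ⁿ⁺¹e)) = mod2^ (two * e , trans d≈2ⁿ⁺¹e
    (solve 3 (λ t P e → (t :* P) :* e := P :* (t :* e)) refl two (pow two n) e))

  ≡-mod-square : ∀ {n x y} → x ≡ y [mod2^ n ] → x * x ≡ y * y [mod2^ n ]
  ≡-mod-square {x = x} {y} (mod2^ 2ⁿ∣x-y) =
    mod2^ (∣-respʳ (solve 2 (λ x y → (x :+ y) :* (x :- y) := x :* x :- y :* y) refl x y) (∣-*ˡ (x + y) 2ⁿ∣x-y))

  -- x² - y² = (x - y)² + 2y(x - y), and both summands gain a factor of 2.
  ≡-mod-square-lift : ∀ {n x y} → x ≡ y [mod2^ suc n ] → x * x ≡ y * y [mod2^ suc (suc n) ]
  ≡-mod-square-lift {n} {x} {y} (mod2^ (e , x-y≈2ⁿ⁺¹e)) = mod2^ (2ⁿ * (e * e) + y * e , (begin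
    x * x - y * y                                ≈⟨ solve 2 (λ x y → x :* x :- y :* y := (x :- y) :* (x :- y) :+ con (+ 2) :* (y :* (x :- y))) refl x y ⟩
    (x - y) * (x - y) + two * (y * (x - y))      ≈⟨ +-cong (*-cong x-y≈2ⁿ⁺¹e x-y≈2ⁿ⁺¹e) (*-congˡ (*-congˡ x-y≈2ⁿ⁺¹e)) ⟩
    ((two * 2ⁿ) * e) * ((two * 2ⁿ) * e) + two * (y * ((two * 2ⁿ) * e))
      ≈⟨ solve 3 (λ q e y → ((con (+ 2) :* q) :* e) :* ((con (+ 2) :* q) :* e) :+ con (+ 2) :* (y :* ((con (+ 2) :* q) :* e))
                         := (con (+ 2) :* (con (+ 2) :* q)) :* (q :* (e :* e) :+ y :* e)) refl 2ⁿ e y ⟩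
    (two * (two * 2ⁿ)) * (2ⁿ * (e * e) + y * e)  ∎))
    where
    2ⁿ = pow two n
    open import Relation.Binary.Reasoning.Setoid setoid

  infixl 8 _^2^_
  _^2^_ : Carrier → ℕ → Carrier
  x ^2^ zero = x
  x ^2^ suc k = (x * x) ^2^ k

  ^2^-+ : ∀ m n x → x ^2^ (m ℕ.+ n) ≡ (x ^2^ m) ^2^ n
  ^2^-+ zero n x = P.refl
  ^2^-+ (suc m) n x = ^2^-+ m n (x * x)

  ^2^-square : ∀ k x → (x * x) ^2^ k ≡ x ^2^ k * x ^2^ k
  ^2^-square zero x = P.refl
  ^2^-square (suc k) x = ^2^-square k (x * x)

  x∣x^2^k : ∀ k x → x ∣ (x ^2^ k)
  x∣x^2^k zero x = 1# , sym (*-identityʳ x)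
  x∣x^2^k (suc k) x = ∣-trans (x∣x*y x x) (x∣x^2^k k (x * x))

  ^2^-cong : ∀ {n} k {x y} → x ≡ y [mod2^ n ] → x ^2^ k ≡ y ^2^ k [mod2^ n ]
  ^2^-cong zero x≡y = x≡y
  ^2^-cong (suc k) x≡y = ^2^-cong k (≡-mod-square x≡y)

  ^2^-lift : ∀ {n} k {x y} → x ≡ y [mod2^ suc n ] → x ^2^ suc k ≡ y ^2^ suc k [mod2^ suc (suc n) ]
  ^2^-lift k x≡y = ^2^-cong k (≡-mod-square-lift x≡y)

  2ⁿ∣⇒2ⁿ⁺¹∣2* : ∀ {n z} → pow two n ∣ z → pow two (suc n) ∣ (two * z)
  2ⁿ∣⇒2ⁿ⁺¹∣2* {n} (e , z≈2ⁿe) = e , trans (*-congˡ z≈2ⁿe) (sym (*-assoc two (pow two n) e))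

  ≡-mod-*ˡ : ∀ {n x y} z → x ≡ y [mod2^ n ] → z * x ≡ z * y [mod2^ n ]
  ≡-mod-*ˡ {x = x} {y} z (mod2^ 2ⁿ∣x-y) =
    mod2^ (∣-respʳ (solve 3 (λ z x y → z :* (x :- y) := z :* x :- z :* y) refl z x y) (∣-*ˡ z 2ⁿ∣x-y))

module Dyadic {c ℓ : Level} (D : UnramifiedDyadic c ℓ) where
  open UnramifiedDyadic D using (domain; two-nonunit; maximal-2R; separated; complete; residue-finite)
  open Hyperbolic D hiding (zero)
  open IntegerSolver 𝓡 using (solve; _:=_; _:+_; _:*_; _:-_; :-_; con)
  open Divisibility 𝓡
  open Congruence 𝓡
  open import Algebra.Properties.Ring ring using (x∙y⁻¹≈ε⇒x≈y)
  open import Relation.Binary.Reasoning.Setoid setoid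

  two∤unit : ∀ {u} → Unit u → ¬ two ∣ u
  two∤unit {u} (u⁻¹ , uu⁻¹≈1) (e , u≈2e) = two-nonunit (e * u⁻¹ , (begin
    two * (e * u⁻¹)   ≈⟨ *-assoc two e u⁻¹ ⟨
    (two * e) * u⁻¹   ≈⟨ *-congʳ u≈2e ⟨
    u * u⁻¹           ≈⟨ uu⁻¹≈1 ⟩
    1#                ∎))

  two∣x*x⇒two∣x : ∀ {x} → two ∣ (x * x) → two ∣ x
  two∣x*x⇒two∣x {x} 2∣x² = maximal-2R x (λ x-unit → two∤unit (Unit-* x-unit x-unit) 2∣x²)

  ≡-mod-all⇒≈ : ∀ {x y} → (∀ n → x ≡ y [mod2^ n ]) → x ≈ y
  ≡-mod-all⇒≈ {x} {y} x≡y = x∙y⁻¹≈ε⇒x≈y x y (separated (x - y) (divides ∘ x≡y))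

  limit : (a : ℕ → Carrier) → (∀ n → a (suc n) ≡ a n [mod2^ n ]) → Σ Carrier λ x → ∀ n → x ≡ a n [mod2^ n ]
  limit a cauchy with x , x≡a ← complete a (divides ∘ cauchy) = x , mod2^ ∘ x≡a

  -- The inverse is the limit of the partial sums g n of the geometric series Σ (-2x)ⁱ.
  1+2x-unit : ∀ x → Unit (1# + two * x)
  1+2x-unit x = v , ≡-mod-all⇒≈ λ n → ≡-mod-trans (≡-mod-*ˡ u (v≡g n)) (ug≡1 n)
    where
    u : Carrier
    u = 1# + two * x

    g : ℕ → Carrier
    g zero = 0#
    g (suc n) = 1# - two * (x * g n)

    contract : ∀ {n e e'} → e' ≈ two * (- x * e) → pow two n ∣ e → pow two (suc n) ∣ e'
    contract {n} e'≈-2xe 2ⁿ∣e = ∣-respʳ (sym e'≈-2xe) (2ⁿ∣⇒2ⁿ⁺¹∣2* {n} (∣-*ˡ (- x) 2ⁿ∣e))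

    g-cauchy : ∀ n → g (suc n) ≡ g n [mod2^ n ]
    g-cauchy zero = mod2^ (1∣x _)
    g-cauchy (suc n) = mod2^ (contract {n}
      (solve 3 (λ x a b → (con (+ 1) :- con (+ 2) :* (x :* a)) :- (con (+ 1) :- con (+ 2) :* (x :* b))
                       := con (+ 2) :* (:- x :* (a :- b))) refl x (g (suc n)) (g n))
      (divides (g-cauchy n)))

    ug≡1 : ∀ n → u * g n ≡ 1# [mod2^ n ]
    ug≡1 zero = mod2^ (1∣x _)
    ug≡1 (suc n) = mod2^ (contract {n}
      (solve 2 (λ x a → (con (+ 1) :+ con (+ 2) :* x) :* (con (+ 1) :- con (+ 2) :* (x :* a)) :- con (+ 1)
                     := con (+ 2) :* (:- x :* ((con (+ 1) :+ con (+ 2) :* x) :* a :- con (+ 1)))) refl x (g n))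
      (divides (ug≡1 n)))

    v : Carrier
    v = proj₁ (limit g g-cauchy)

    v≡g : ∀ n → v ≡ g n [mod2^ n ]
    v≡g = proj₂ (limit g g-cauchy)

  Unit-resp-≡mod2 : ∀ {u x} → Unit u → two ∣ (x - u) → Unit x
  Unit-resp-≡mod2 {u} {x} u-unit@(u⁻¹ , uu⁻¹≈1) (d , x-u≈2d) =
    Unit-resp u[1+2du⁻¹]≈x (Unit-* u-unit (1+2x-unit (d * u⁻¹)))
    where
    u[1+2du⁻¹]≈x : u * (1# + two * (d * u⁻¹)) ≈ x
    u[1+2du⁻¹]≈x = begin
      u * (1# + two * (d * u⁻¹))  ≈⟨ solve 3 (λ u u' d → u :* (con (+ 1) :+ con (+ 2) :* (d :* u')) := u :+ con (+ 2) :* d :* (u :* u')) refl u u⁻¹ d ⟩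
      u + two * d * (u * u⁻¹)     ≈⟨ +-congˡ (*-congˡ uu⁻¹≈1) ⟩
      u + two * d * 1#            ≈⟨ +-congˡ (trans (*-identityʳ _) (sym x-u≈2d)) ⟩
      u + (x - u)                 ≈⟨ solve 2 (λ u x → u :+ (x :- u) := x) refl u x ⟩
      x                           ∎

  ^2^-injective-mod2 : ∀ k {x y} → two ∣ (x ^2^ k - y ^2^ k) → two ∣ (x - y)
  ^2^-injective-mod2 zero 2∣x-y = 2∣x-y
  ^2^-injective-mod2 (suc k) {x} {y} 2∣difference = two∣x*x⇒two∣x (∣-respʳ
    (solve 2 (λ x y → (x :* x :- y :* y) :- con (+ 2) :* (y :* (x :- y)) := (x :- y) :* (x :- y)) refl x y)
    (∣-- (^2^-injective-mod2 k 2∣difference) (x∣x*y two (y * (x - y)))))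

  private
    reps : List Carrier
    reps = proj₁ residue-finite

    cover : ∀ x → Any (λ r → two ∣ (x - r)) reps
    cover = proj₂ residue-finite

    class : Carrier → Fin (length reps)
    class y = Any.index (cover y)

    same-class⇒two∣- : ∀ {y z} → class y ≡ class z → two ∣ (y - z)
    same-class⇒two∣- {y} {z} same = ∣-respʳ
      (solve 3 (λ y z r → (y :- r) :- (z :- r) := y :- z) refl y z (lookup reps (class y)))
      (∣-- (lookup-index (cover y)) (P.subst (λ k → two ∣ (z - lookup reps k)) (P.sym same) (lookup-index (cover z))))

  -- The next proofs are opaque: with-abstraction over them would otherwise unfold them, which is prohibitively slow.
  opaque
    -- Pigeonhole on the residue classes of x, x², x⁴, …, then cancel the common squarings.
    frobenius-periodic : ∀ x → Σ ℕ λ s → two ∣ (x ^2^ suc s - x)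
    frobenius-periodic x
      with i , j , i<j , same ← pigeonhole (ℕP.n<1+n (length reps)) (λ k → class (x ^2^ toℕ k))
      with s , 1+i+s≡j ← ℕP.m≤n⇒∃[o]m+o≡n i<j
      = s , ^2^-injective-mod2 (toℕ i) (P.subst (λ w → two ∣ (w - x ^2^ toℕ i)) xʲ≡ (same-class⇒two∣- (P.sym same)))
      where
      xʲ≡ : x ^2^ toℕ j ≡ (x ^2^ suc s) ^2^ toℕ i
      xʲ≡ = P.trans (P.cong (x ^2^_) (P.trans (P.sym 1+i+s≡j) (P.cong suc (ℕP.+-comm (toℕ i) s))))
                    (^2^-+ (suc s) (toℕ i) x)

    -- ω is the limit of z m = x ^2^ ((s + 1) m), which converges because squaring improves congruences mod 2ⁿ⁺¹.
    teichmüller : ∀ {x} s → two ∣ (x ^2^ suc s - x) → Σ Carrier λ ω → ω ^2^ suc s ≈ ω × two ∣ (ω - x)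
    teichmüller {x} s periodic = ω , ω-fixed , ≡[mod2^1]⇒two∣ (≡-mod-trans (ω≡z 1) (z-cauchy 0))
      where
      z : ℕ → Carrier
      z zero = x
      z (suc m) = z m ^2^ suc s

      z-cauchy : ∀ m → z (suc m) ≡ z m [mod2^ suc m ]
      z-cauchy zero = two∣⇒≡[mod2^1] periodic
      z-cauchy (suc m) = ^2^-lift s (z-cauchy m)

      ω : Carrier
      ω = proj₁ (limit z (≡-mod-pred ∘ z-cauchy))

      ω≡z : ∀ n → ω ≡ z n [mod2^ n ]
      ω≡z = proj₂ (limit z (≡-mod-pred ∘ z-cauchy))

      ω-fixed : ω ^2^ suc s ≈ ω
      ω-fixed = ≡-mod-all⇒≈ λ n → ≡-mod-trans (^2^-cong (suc s) (ω≡z n)) (≡-mod-sym (≡-mod-pred (ω≡z (suc n))))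

  ^2^-fixed⇒≈0⊎Unit : ∀ s {ω} → ω ^2^ suc s ≈ ω → ω ≈ 0# ⊎ Unit ω
  ^2^-fixed⇒≈0⊎Unit s {ω} ω-fixed with h , ω^2^[1+s]≈ω²h ← x∣x^2^k s (ω * ω) =
    Sum.map₂ (λ ωh-1≈0 → h , x∙y⁻¹≈ε⇒x≈y _ _ ωh-1≈0) (domain ω (ω * h - 1#) ω[ωh-1]≈0)
    where
    ω[ωh-1]≈0 : ω * (ω * h - 1#) ≈ 0#
    ω[ωh-1]≈0 = begin
      ω * (ω * h - 1#)   ≈⟨ solve 2 (λ ω h → ω :* (ω :* h :- con (+ 1)) := (ω :* ω) :* h :- ω) refl ω h ⟩
      (ω * ω) * h - ω    ≈⟨ +-congʳ ω^2^[1+s]≈ω²h ⟨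
      ω ^2^ suc s - ω    ≈⟨ +-congʳ ω-fixed ⟩
      ω - ω              ≈⟨ -‿inverseʳ ω ⟩
      0#                 ∎

  opaque
    Unit⊎two∣ : ∀ x → Unit x ⊎ two ∣ x
    Unit⊎two∣ x =
      let s , periodic = frobenius-periodic x
          ω , ω-fixed , 2∣ω-x = teichmüller s periodic
      in [ (λ ω≈0 → inj₂ (∣-respʳ (solve 2 (λ ω x → ω :- (ω :- x) := x) refl ω x) (∣-- (≈0⇒∣ ω≈0) 2∣ω-x)))
         , (λ ω-unit → inj₁ (Unit-resp-≡mod2 ω-unit (∣-respʳ (solve 2 (λ ω x → :- (ω :- x) := x :- ω) refl ω x) (∣-neg 2∣ω-x))))
         ]′ (^2^-fixed⇒≈0⊎Unit s ω-fixed)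

  Unit? : ∀ x → Dec (Unit x)
  Unit? x with Unit⊎two∣ x
  ... | inj₁ x-unit = yes x-unit
  ... | inj₂ 2∣x = no λ x-unit → two∤unit x-unit 2∣x

  square-root-mod2 : ∀ a → Σ Carrier λ u → two ∣ (u * u - a)
  square-root-mod2 a with frobenius-periodic a
  ... | s , 2∣a^2^[1+s]-a = a ^2^ s , P.subst (λ w → two ∣ (w - a)) (^2^-square s a) 2∣a^2^[1+s]-a

  -- If no residue representative r has r and r - 1 both units, every residue class is that of 0 or 1.
  ¬IsZ₂⇒unit-pair : ¬ IsZ₂ → Σ Carrier λ η → Unit η × Unit (η - 1#)
  ¬IsZ₂⇒unit-pair ¬Z₂ with Any.any? (λ r → Unit? r ×-dec Unit? (r - 1#)) reps
  ... | yes found = Any.satisfied found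
  ... | no none = ⊥-elim (¬Z₂ λ x → residue-0-or-1 (lookupAny (¬Any⇒All¬ reps none) (cover x)))
    where
    residue-0-or-1 : ∀ {x r} → ¬ (Unit r × Unit (r - 1#)) × two ∣ (x - r) → two ∣ x ⊎ two ∣ (x - 1#)
    residue-0-or-1 {x} {r} (not-both , 2∣x-r) with Unit⊎two∣ r | Unit⊎two∣ (r - 1#)
    ... | inj₂ 2∣r | _ = inj₁ (∣-respʳ (solve 2 (λ x r → (x :- r) :+ r := x) refl x r) (∣-+ 2∣x-r 2∣r))
    ... | inj₁ _ | inj₂ 2∣r-1 = inj₂ (∣-respʳ (solve 2 (λ x r → (x :- r) :+ (r :- con (+ 1)) := x :- con (+ 1)) refl x r) (∣-+ 2∣x-r 2∣r-1))
    ... | inj₁ r-unit | inj₁ r-1-unit = ⊥-elim (not-both (r-unit , r-1-unit))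

module HyperbolicPlane {c ℓ : Level} (D : UnramifiedDyadic c ℓ) where
  open Hyperbolic D hiding (zero)
  open IntegerSolver 𝓡 using (solve; _:=_; _:+_; _:*_; _:-_; :-_; con)
  open Divisibility 𝓡
  open Dyadic D
  open import Algebra.Properties.Ring ring using (x∙y⁻¹≈ε⇒x≈y; x≈y⇒x∙y⁻¹≈ε)
  open import Relation.Binary.Reasoning.Setoid setoid

  span : L → Submodule
  span (p , q) = record
    { mem = λ n → Σ Carrier λ β → n ≈L (β ·L (p , q))
    ; mem-resp = λ { (u₁≈w₁ , u₂≈w₂) (β , u₁≈βp , u₂≈βq) → β , trans (sym u₁≈w₁) u₁≈βp , trans (sym u₂≈w₂) u₂≈βq }
    ; mem-0 = 0# , sym (zeroˡ p) , sym (zeroˡ q)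
    ; mem-+ = λ { (β , u₁≈βp , u₂≈βq) (γ , w₁≈γp , w₂≈γq) →
        β + γ , trans (+-cong u₁≈βp w₁≈γp) (sym (distribʳ p β γ)) , trans (+-cong u₂≈βq w₂≈γq) (sym (distribʳ q β γ)) }
    ; mem-· = λ { a (β , u₁≈βp , u₂≈βq) → a * β , trans (*-congˡ u₁≈βp) (sym (*-assoc a β p)) , trans (*-congˡ u₂≈βq) (sym (*-assoc a β q)) }
    }

  -- The complement is span (p , q); coordinates with respect to (x , y), (p , q) come from Cramer's rule.
  det-unit⇒Primitive : ∀ {x y} p q → Unit (x * q - y * p) → Primitive (x , y)
  det-unit⇒Primitive {x} {y} p q (δ⁻¹ , δδ⁻¹≈1) = span (p , q) , decompose , unique
    where
    δ : Carrier
    δ = x * q - y * p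

    decompose : ∀ u → Σ Carrier λ a → Σ L λ n → Submodule.mem (span (p , q)) n × (u ≈L ((a ·L (x , y)) +L n))
    decompose (u₁ , u₂) = (u₁ * q - u₂ * p) * δ⁻¹ , (β * p , β * q) , (β , refl , refl) ,
      (sym (begin
        ((u₁ * q - u₂ * p) * δ⁻¹) * x + β * p
          ≈⟨ solve 7 (λ u₁ u₂ x y p q d → ((u₁ :* q :- u₂ :* p) :* d) :* x :+ ((x :* u₂ :- y :* u₁) :* d) :* p
                                        := u₁ :* ((x :* q :- y :* p) :* d)) refl u₁ u₂ x y p q δ⁻¹ ⟩
        u₁ * (δ * δ⁻¹)  ≈⟨ *-congˡ δδ⁻¹≈1 ⟩
        u₁ * 1#         ≈⟨ *-identityʳ u₁ ⟩
        u₁              ∎)) ,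
      (sym (begin
        ((u₁ * q - u₂ * p) * δ⁻¹) * y + β * q
          ≈⟨ solve 7 (λ u₁ u₂ x y p q d → ((u₁ :* q :- u₂ :* p) :* d) :* y :+ ((x :* u₂ :- y :* u₁) :* d) :* q
                                        := u₂ :* ((x :* q :- y :* p) :* d)) refl u₁ u₂ x y p q δ⁻¹ ⟩
        u₂ * (δ * δ⁻¹)  ≈⟨ *-congˡ δδ⁻¹≈1 ⟩
        u₂ * 1#         ≈⟨ *-identityʳ u₂ ⟩
        u₂              ∎))
      where
      β : Carrier
      β = (x * u₂ - y * u₁) * δ⁻¹

    unique : ∀ a b n m → Submodule.mem (span (p , q)) n → Submodule.mem (span (p , q)) m →
             ((a ·L (x , y)) +L n) ≈L ((b ·L (x , y)) +L m) → (a ·L (x , y)) ≈L (b ·L (x , y))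
    unique a b n m (β , n₁≈βp , n₂≈βq) (γ , m₁≈γp , m₂≈γq) (e₁ , e₂) = *-congʳ a≈b , *-congʳ a≈b
      where
      E₁ : a * x + β * p - (b * x + γ * p) ≈ 0#
      E₁ = x≈y⇒x∙y⁻¹≈ε (trans (+-congˡ (sym n₁≈βp)) (trans e₁ (+-congˡ m₁≈γp)))
      E₂ : a * y + β * q - (b * y + γ * q) ≈ 0#
      E₂ = x≈y⇒x∙y⁻¹≈ε (trans (+-congˡ (sym n₂≈βq)) (trans e₂ (+-congˡ m₂≈γq)))
      δ[a-b]≈0 : δ * (a - b) ≈ 0#
      δ[a-b]≈0 = begin
        δ * (a - b)
          ≈⟨ solve 8 (λ a b x y p q β γ → (x :* q :- y :* p) :* (a :- b)
               := q :* ((a :* x :+ β :* p) :- (b :* x :+ γ :* p)) :- p :* ((a :* y :+ β :* q) :- (b :* y :+ γ :* q))) refl a b x y p q β γ ⟩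
        q * (a * x + β * p - (b * x + γ * p)) - p * (a * y + β * q - (b * y + γ * q))
          ≈⟨ +-cong (*-congˡ E₁) (-‿cong (*-congˡ E₂)) ⟩
        q * 0# - p * 0#  ≈⟨ solve 2 (λ q p → q :* con (+ 0) :- p :* con (+ 0) := con (+ 0)) refl q p ⟩
        0#               ∎
      a≈b : a ≈ b
      a≈b = x∙y⁻¹≈ε⇒x≈y a b (Unit-cancelˡ (δ⁻¹ , δδ⁻¹≈1) δ[a-b]≈0)

  Unitˡ⇒Primitive : ∀ {x y} → Unit x → Primitive (x , y)
  Unitˡ⇒Primitive {x} {y} x-unit =
    det-unit⇒Primitive 0# 1# (Unit-resp (solve 2 (λ x y → x := x :* con (+ 1) :- y :* con (+ 0)) refl x y) x-unit)

  -- If v = 2 w, writing w = c v + n gives v = 2c v + 2n, so 2c v = v and (1 - 2c) v = 0 with 1 - 2c a unit.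
  Primitive-2∣⇒≈0 : ∀ {x y} → Primitive (x , y) → two ∣ x → two ∣ y → x ≈ 0# × y ≈ 0#
  Primitive-2∣⇒≈0 {x} {y} (N , decompose , unique) (x' , x≈2x') (y' , y≈2y') = go (decompose (x' , y'))
    where
    open Submodule N
    go : (Σ Carrier λ c → Σ L λ n → mem n × ((x' , y') ≈L ((c ·L (x , y)) +L n))) → x ≈ 0# × y ≈ 0#
    go (c , (n₁ , n₂) , n∈N , x'≈cx+n₁ , y'≈cy+n₂) = cancel (proj₁ 2c·v≈1·v) , cancel (proj₂ 2c·v≈1·v)
      where
      coordinate : ∀ {z z' m} → z ≈ two * z' → z' ≈ c * z + m → (two * c) * z + two * m ≈ 1# * z + 0#
      coordinate {z} {z'} {m} z≈2z' z'≈cz+m = begin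
        (two * c) * z + two * m  ≈⟨ solve 3 (λ c z m → (con (+ 2) :* c) :* z :+ con (+ 2) :* m := con (+ 2) :* (c :* z :+ m)) refl c z m ⟩
        two * (c * z + m)        ≈⟨ *-congˡ z'≈cz+m ⟨
        two * z'                 ≈⟨ z≈2z' ⟨
        z                        ≈⟨ solve 1 (λ z → z := con (+ 1) :* z :+ con (+ 0)) refl z ⟩
        1# * z + 0#              ∎

      2c·v≈1·v : ((two * c) ·L (x , y)) ≈L (1# ·L (x , y))
      2c·v≈1·v = unique (two * c) 1# _ 0L (mem-· two n∈N) mem-0 (coordinate x≈2x' x'≈cx+n₁ , coordinate y≈2y' y'≈cy+n₂)

      cancel : ∀ {z} → (two * c) * z ≈ 1# * z → z ≈ 0#
      cancel {z} 2cz≈z = Unit-cancelˡ (1+2x-unit (- c)) (begin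
        (1# + two * - c) * z      ≈⟨ solve 2 (λ c z → (con (+ 1) :+ con (+ 2) :* (:- c)) :* z := con (+ 1) :* z :- (con (+ 2) :* c) :* z) refl c z ⟩
        1# * z - (two * c) * z    ≈⟨ x≈y⇒x∙y⁻¹≈ε (sym 2cz≈z) ⟩
        0#                        ∎)

  x-y-unit⇒Q-unit : ∀ {x y} → Unit (x - y) → Unit (Q (x , y))
  x-y-unit⇒Q-unit {x} {y} x-y-unit = Unit-resp (solve 2 (λ x y → (x :- y) :* (x :+ y) := x :* x :- y :* y) refl x y)
    (Unit-* x-y-unit (Unit-resp-≡mod2 x-y-unit (y , solve 2 (λ x y → (x :+ y) :- (x :- y) := con (+ 2) :* y) refl x y)))

  Q≈4s[s+y] : ∀ {x y s} → x - y ≈ two * s → Q (x , y) ≈ four * (s * (s + y))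
  Q≈4s[s+y] {x} {y} {s} x-y≈2s = begin
    x * x - y * y                      ≈⟨ solve 2 (λ x y → x :* x :- y :* y := (x :- y) :* ((x :- y) :+ con (+ 2) :* y)) refl x y ⟩
    (x - y) * ((x - y) + two * y)      ≈⟨ *-cong x-y≈2s (+-congʳ x-y≈2s) ⟩
    (two * s) * (two * s + two * y)    ≈⟨ solve 2 (λ s y → (con (+ 2) :* s) :* (con (+ 2) :* s :+ con (+ 2) :* y) := con (+ 4) :* (s :* (s :+ y))) refl s y ⟩
    four * (s * (s + y))               ∎

  Q[η+cη',cη'-η]≈4c : ∀ {η η'} c → η * η' ≈ 1# → Q (η + c * η' , c * η' - η) ≈ four * c
  Q[η+cη',cη'-η]≈4c {η} {η'} c ηη'≈1 = begin
    (η + c * η') * (η + c * η') - (c * η' - η) * (c * η' - η)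
      ≈⟨ solve 3 (λ η c η' → (η :+ c :* η') :* (η :+ c :* η') :- (c :* η' :- η) :* (c :* η' :- η) := (con (+ 4) :* c) :* (η :* η')) refl η c η' ⟩
    (four * c) * (η * η')  ≈⟨ *-congˡ ηη'≈1 ⟩
    (four * c) * 1#        ≈⟨ *-identityʳ _ ⟩
    four * c               ∎

  InQ*⇒InQ : ∀ {a} → InQ* a → InQ a
  InQ*⇒InQ (v , _ , Qv≈a) = v , Qv≈a

  InQ⇒Unit⊎4∣ : ∀ {a} → InQ a → Unit a ⊎ four ∣ a
  InQ⇒Unit⊎4∣ ((x , y) , Qv≈a) with Unit⊎two∣ (x - y)
  ... | inj₁ x-y-unit = inj₁ (Unit-resp Qv≈a (x-y-unit⇒Q-unit x-y-unit))
  ... | inj₂ (s , x-y≈2s) = inj₂ (s * (s + y) , trans (sym Qv≈a) (Q≈4s[s+y] x-y≈2s))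

  Q≈0 : ∀ {x y} → x ≈ 0# × y ≈ 0# → Q (x , y) ≈ 0#
  Q≈0 (x≈0 , y≈0) = trans (+-cong (*-cong x≈0 x≈0) (-‿cong (*-cong y≈0 y≈0)))
    (solve 0 (con (+ 0) :* con (+ 0) :- con (+ 0) :* con (+ 0) := con (+ 0)) refl)

  IsZ₂⇒two∣s[s+y] : IsZ₂ → ∀ s {y} → two ∣ (y - 1#) → two ∣ (s * (s + y))
  IsZ₂⇒two∣s[s+y] Z₂ s {y} 2∣y-1 with Z₂ s
  ... | inj₁ 2∣s = ∣-*ʳ (s + y) 2∣s
  ... | inj₂ 2∣s-1 = ∣-*ˡ s (∣-respʳ (solve 2 (λ s y → ((s :- con (+ 1)) :+ (y :- con (+ 1))) :+ con (+ 2) :* con (+ 1) := s :+ y) refl s y)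
                                    (∣-+ (∣-+ 2∣s-1 2∣y-1) (x∣x*y two 1#)))

  two∣⇒eight∣four* : ∀ {m} → two ∣ m → eight ∣ (four * m)
  two∣⇒eight∣four* (d , m≈2d) = d , trans (*-congˡ m≈2d) (solve 1 (λ d → con (+ 4) :* (con (+ 2) :* d) := con (+ 8) :* d) refl d)

  -- Over ℤ₂ either both coordinates are even, which primitivity forbids unless v = 0, or y is odd.
  IsZ₂⇒InQ*⇒Unit⊎8∣ : IsZ₂ → ∀ {a} → InQ* a → Unit a ⊎ eight ∣ a
  IsZ₂⇒InQ*⇒Unit⊎8∣ Z₂ ((x , y) , v-primitive , Qv≈a) with Unit⊎two∣ (x - y)
  ... | inj₁ x-y-unit = inj₁ (Unit-resp Qv≈a (x-y-unit⇒Q-unit x-y-unit))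
  ... | inj₂ (s , x-y≈2s) with Z₂ y
  ...   | inj₁ 2∣y = inj₂ (≈0⇒∣ (trans (sym Qv≈a) (Q≈0 (Primitive-2∣⇒≈0 v-primitive 2∣x 2∣y))))
    where
    2∣x : two ∣ x
    2∣x = ∣-respʳ (solve 2 (λ x y → (x :- y) :+ y := x) refl x y) (∣-+ (s , x-y≈2s) 2∣y)
  ...   | inj₂ 2∣y-1 = inj₂ (∣-respʳ (sym (trans (sym Qv≈a) (Q≈4s[s+y] x-y≈2s))) (two∣⇒eight∣four* (IsZ₂⇒two∣s[s+y] Z₂ s 2∣y-1)))

  Unit⇒InQ* : ∀ {a} → Unit a → InQ* a
  Unit⇒InQ* {a} a-unit with u , (k , u²-a≈2k) ← square-root-mod2 a = v , v-primitive , Qv≈a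
    where
    u-unit : Unit u
    u-unit = Unit-*⇒Unitˡ (Unit-resp-≡mod2 a-unit (k , u²-a≈2k))

    w : Carrier
    w = proj₁ u-unit

    v : L
    v = (u - k * w , - (k * w))

    Qv≈a : Q v ≈ a
    Qv≈a = begin
      (u - k * w) * (u - k * w) - (- (k * w)) * (- (k * w))
        ≈⟨ solve 3 (λ u k w → (u :- k :* w) :* (u :- k :* w) :- (:- (k :* w)) :* (:- (k :* w)) := u :* u :- (con (+ 2) :* k) :* (u :* w)) refl u k w ⟩
      u * u - (two * k) * (u * w)  ≈⟨ +-congˡ (-‿cong (*-congˡ (proj₂ u-unit))) ⟩
      u * u - (two * k) * 1#       ≈⟨ +-congˡ (-‿cong (trans (*-identityʳ _) (sym u²-a≈2k))) ⟩
      u * u - (u * u - a)          ≈⟨ solve 2 (λ U a → U :- (U :- a) := a) refl (u * u) a ⟩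
      a                            ∎

    v-primitive : Primitive v
    v-primitive = det-unit⇒Primitive 1# 1# (Unit-resp (solve 3 (λ u k w → u := (u :- k :* w) :* con (+ 1) :- (:- (k :* w)) :* con (+ 1)) refl u k w) u-unit)

  four-multiple-InQ* : ∀ {a η η'} c → a ≈ four * c → η * η' ≈ 1# → Unit (η + c * η') → InQ* a
  four-multiple-InQ* c a≈4c ηη'≈1 η+cη'-unit = _ , Unitˡ⇒Primitive η+cη'-unit , trans (Q[η+cη',cη'-η]≈4c c ηη'≈1) (sym a≈4c)

  four∣⇒InQ : ∀ {a} → four ∣ a → InQ a
  four∣⇒InQ (c , a≈4c) = _ , trans (Q[η+cη',cη'-η]≈4c c (*-identityʳ 1#)) (sym a≈4c)

  eight∣⇒InQ* : ∀ {a} → eight ∣ a → InQ* a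
  eight∣⇒InQ* (c , a≈8c) = four-multiple-InQ* (two * c)
    (trans a≈8c (solve 1 (λ c → con (+ 8) :* c := con (+ 4) :* (con (+ 2) :* c)) refl c)) (*-identityʳ 1#)
    (Unit-resp (+-congˡ (sym (*-identityʳ _))) (1+2x-unit c))

  -- η - η⁻¹ = η⁻¹ (η - 1)(η + 1) is a unit, and η + c η⁻¹ ≡ η - η⁻¹ when c ≡ -1 (mod 2).
  unit-pair⇒Unit[η+cη⁻¹] : ∀ {η η' c} → η * η' ≈ 1# → Unit (η - 1#) → two ∣ (1# + c) → Unit (η + c * η')
  unit-pair⇒Unit[η+cη⁻¹] {η} {η'} {c} ηη'≈1 η-1-unit (d , 1+c≈2d) =
    Unit-resp-≡mod2 η-η'-unit (η' * d , (begin
      (η + c * η') - (η - η')  ≈⟨ solve 3 (λ η c η' → (η :+ c :* η') :- (η :- η') := (con (+ 1) :+ c) :* η') refl η c η' ⟩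
      (1# + c) * η'            ≈⟨ *-congʳ 1+c≈2d ⟩
      (two * d) * η'           ≈⟨ solve 3 (λ t d η' → (t :* d) :* η' := t :* (η' :* d)) refl two d η' ⟩
      two * (η' * d)           ∎))
    where
    η+1-unit : Unit (η + 1#)
    η+1-unit = Unit-resp-≡mod2 η-1-unit (1# , solve 1 (λ η → (η :+ con (+ 1)) :- (η :- con (+ 1)) := con (+ 2) :* con (+ 1)) refl η)
    η'-unit : Unit η'
    η'-unit = η , trans (*-comm η' η) ηη'≈1
    η-η'-unit : Unit (η - η')
    η-η'-unit = Unit-resp (begin
      η' * ((η - 1#) * (η + 1#))  ≈⟨ solve 2 (λ η η' → η' :* ((η :- con (+ 1)) :* (η :+ con (+ 1))) := η :* (η :* η') :- η') refl η η' ⟩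
      η * (η * η') - η'           ≈⟨ +-congʳ (trans (*-congˡ ηη'≈1) (*-identityʳ η)) ⟩
      η - η'                      ∎) (Unit-* η'-unit (Unit-* η-1-unit η+1-unit))

  ¬IsZ₂⇒four∣⇒InQ* : ¬ IsZ₂ → ∀ {a} → four ∣ a → InQ* a
  ¬IsZ₂⇒four∣⇒InQ* ¬Z₂ (c , a≈4c) with Unit⊎two∣ (1# + c)
  ... | inj₁ 1+c-unit = four-multiple-InQ* c a≈4c (*-identityʳ 1#) (Unit-resp (+-congˡ (sym (*-identityʳ c))) 1+c-unit)
  ... | inj₂ 2∣1+c with η , (η' , ηη'≈1) , η-1-unit ← ¬IsZ₂⇒unit-pair ¬Z₂ =
    four-multiple-InQ* c a≈4c ηη'≈1 (unit-pair⇒Unit[η+cη⁻¹] ηη'≈1 η-1-unit 2∣1+c)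

lemma5p1 : {c ℓ : Level} (D : UnramifiedDyadic c ℓ) →
    let open Hyperbolic D in
    (∀ a → InQ a ⇔ (Unit a ⊎ (four ∣ a))) ×
    ((¬ IsZ₂ → ∀ a → InQ* a ⇔ (Unit a ⊎ (four ∣ a))) ×
     (IsZ₂ → ∀ a → InQ* a ⇔ (Unit a ⊎ (eight ∣ a))))
lemma5p1 D =
  (λ a → mk⇔ InQ⇒Unit⊎4∣ [ InQ*⇒InQ ∘ Unit⇒InQ* , four∣⇒InQ ]) ,
  (λ ¬Z₂ a → mk⇔ (InQ⇒Unit⊎4∣ ∘ InQ*⇒InQ) [ Unit⇒InQ* , ¬IsZ₂⇒four∣⇒InQ* ¬Z₂ ]) ,
  (λ Z₂ a → mk⇔ (IsZ₂⇒InQ*⇒Unit⊎8∣ Z₂) [ Unit⇒InQ* , eight∣⇒InQ* ])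
  where open HyperbolicPlane D
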